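{- Let $\ell\geq 2$ be an integer, let $j=2(\ell^2-1)$ and $n=j^2-2$. Then for all integers $k$, $$ r_k(n)=f_k^+(j)\, f_k^-(j), \qquad f_k^{\pm}(j)=\frac{\ell\, r_k(j)\pm\delta_k}{\ell\pm 1}, \qquad \delta_k=(-1)^{\lfloor (k+1)/2\rfloor}, $$ and $f_k^{+}(j), f_k^{ - }(j)\in\mathbb{Z}$ for all $k$.
   Context: For an integer $m$, the sequence $(r_k(m))_{k\in\mathbb{Z}}$ is defined by $r_0(m)=1$, $r_1(m)=m-1$ and $r_{k+2}(m)=m\,r_{k+1}(m)-r_k(m)$ for all $k\in\mathbb{Z}$. -}

module Defs where

open import Data.Nat using (ℕ; zero; suc)
open import Data.Integer using (ℤ; +_; -[1+_]; _+_; _-_; _*_; -_; _^_; _/ℕ_; ∣_∣)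

rFwd : ℤ → ℕ → ℤ
rFwd m zero = + 1
rFwd m (suc zero) = m - + 1
rFwd m (suc (suc k)) = m * rFwd m (suc k) - rFwd m k

-- Backward part: rBwd m k = r_{-k}(m); the recurrence read backwards is
-- r_k = m r_{k+1} - r_{k+2}, giving r_0 = 1, r_{-1} = m r_0 - r_1 = 1.
rBwd : ℤ → ℕ → ℤ
rBwd m zero = + 1
rBwd m (suc zero) = m * + 1 - (m - + 1)
rBwd m (suc (suc k)) = m * rBwd m (suc k) - rBwd m k

r : ℤ → ℤ → ℤ
r (+ k) m = rFwd m k
r -[1+ k ] m = rBwd m (suc k)

-- δ_k = (-1)^⌊(k+1)/2⌋  (_/ℕ_ on ℤ rounds toward -∞, i.e. it is the floor)
δ : ℤ → ℤ
δ k = (- + 1) ^ ∣ (k + + 1) /ℕ 2 ∣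

{-# OPTIONS --safe #-}
module Submission where

-- For k ≥ 0 everything follows from the doubling identity
-- (j + 2) r_k(j)² = j r_k(j² − 2) + 2, valid for every j (writing j = x + x⁻¹,
-- both sides equal x^(2k+1) + x^(−2k−1) + 2). For j = 2(ℓ² − 1) we have j + 2 = 2ℓ²,
-- and since δ_k² = 1 the identity becomes
-- (ℓ r_k(j) + δ_k)(ℓ r_k(j) − δ_k) = (ℓ² − 1) r_k(n).
-- The quotients of the two factors by ℓ ± 1 obey a recurrence driven by r_k(j), because
-- ℓ ± 1 divides ℓ j and δ_{k+2} = −δ_k. Negative k reduce to k ≥ 0 through
-- r_{−1−k} = r_k and δ_{−1−k} = δ_k. The final step cancels j, which is nonzero
-- since ℓ ≥ 2.

open import Defs
open import Data.Integer using (ℤ; +_; _+_; _-_; _*_; _≤_)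
open import Data.Product using (Σ; _×_)
open import Relation.Binary.PropositionalEquality using (_≡_)

open import Data.Nat as ℕ using (ℕ; zero; suc; s≤s; z≤n)
import Data.Nat.DivMod as ℕ
import Data.Nat.Properties as ℕ
open import Data.Integer using (-[1+_]; -_; _^_; _/ℕ_; ∣_∣; +≤+; NonZero)
open import Data.Integer.Properties
  using (∣-i∣≡∣i∣; -1*i≡-i; *-identityˡ; ^-distribˡ-+-*; ^-*-assoc; ^-zeroˡ; *-cancelˡ-≡)
open import Data.Integer.Tactic.RingSolver using (solve)
open import Data.List using (_∷_; [])
open import Data.Product using (_,_; proj₁)
open import Relation.Binary.PropositionalEquality using (refl; sym; trans; cong; cong₂)
open Relation.Binary.PropositionalEquality.≡-Reasoning

[2+n]/2≡1+n/2 : ∀ n → suc (suc n) ℕ./ 2 ≡ suc (n ℕ./ 2)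
[2+n]/2≡1+n/2 n = ℕ.m/n≡1+[m∸n]/n {suc (suc n)} (s≤s (s≤s z≤n))

∣-[1+n]/ℕ2∣≡⌈[1+n]/2⌉ : ∀ n → ∣ -[1+ n ] /ℕ 2 ∣ ≡ (suc n ℕ.+ 1) ℕ./ 2
∣-[1+n]/ℕ2∣≡⌈[1+n]/2⌉ zero = refl
∣-[1+n]/ℕ2∣≡⌈[1+n]/2⌉ (suc zero) = refl
∣-[1+n]/ℕ2∣≡⌈[1+n]/2⌉ (suc (suc n)) = begin
  ∣ -[1+ suc (suc n) ] /ℕ 2 ∣ ≡⟨ step n ⟩
  suc ∣ -[1+ n ] /ℕ 2 ∣       ≡⟨ cong suc (∣-[1+n]/ℕ2∣≡⌈[1+n]/2⌉ n) ⟩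
  suc ((suc n ℕ.+ 1) ℕ./ 2)   ≡⟨ [2+n]/2≡1+n/2 (suc n ℕ.+ 1) ⟨
  (suc (suc (suc n)) ℕ.+ 1) ℕ./ 2 ∎
  where
  -- suc (suc (suc k)) % 2 and suc k % 2 are definitionally equal, so the case split of
  -- _/ℕ_ on negative numbers is shared by both sides.
  step : ∀ k → ∣ -[1+ suc (suc k) ] /ℕ 2 ∣ ≡ suc ∣ -[1+ k ] /ℕ 2 ∣
  step k with suc k ℕ.% 2
  ... | zero rewrite ∣-i∣≡∣i∣ (+ (suc (suc (suc k)) ℕ./ 2)) | ∣-i∣≡∣i∣ (+ (suc k ℕ./ 2))
    = [2+n]/2≡1+n/2 (suc k)
  ... | suc _ = cong suc ([2+n]/2≡1+n/2 (suc k))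

δ-neg : ∀ t → δ -[1+ t ] ≡ δ (+ t)
δ-neg zero = refl
δ-neg (suc t) = cong ((- + 1) ^_) (∣-[1+n]/ℕ2∣≡⌈[1+n]/2⌉ t)

δ-suc-suc : ∀ t → δ (+ suc (suc t)) ≡ - δ (+ t)
δ-suc-suc t = trans (cong ((- + 1) ^_) ([2+n]/2≡1+n/2 (t ℕ.+ 1))) (-1*i≡-i (δ (+ t)))

δ*δ≡1 : ∀ k → δ k * δ k ≡ + 1
δ*δ≡1 k = let e = ∣ (k + + 1) /ℕ 2 ∣ in begin
  (- + 1) ^ e * (- + 1) ^ e  ≡⟨ ^-distribˡ-+-* (- + 1) e e ⟨
  (- + 1) ^ (e ℕ.+ e)        ≡⟨ cong (λ x → (- + 1) ^ (e ℕ.+ x)) (ℕ.+-identityʳ e) ⟨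
  (- + 1) ^ (2 ℕ.* e)        ≡⟨ ^-*-assoc (- + 1) 2 e ⟨
  (+ 1) ^ e                  ≡⟨ ^-zeroˡ e ⟩
  + 1                        ∎

r-neg : ∀ {m} t → r -[1+ t ] m ≡ r (+ t) m
r-neg {m} zero = begin
  m * + 1 - (m - + 1) ≡⟨ solve (m ∷ []) ⟩
  + 1                 ∎
r-neg {m} (suc zero) = begin
  m * (m * + 1 - (m - + 1)) - + 1 ≡⟨ solve (m ∷ []) ⟩
  m - + 1                         ∎
r-neg {m} (suc (suc t)) = cong₂ (λ x y → m * x - y) (r-neg (suc t)) (r-neg t)

-- a₀, a₁ and b₀, b₁ stand for consecutive values of r_t(j) and r_t(j² − 2).
doubling-step : ∀ {j a₀ a₁ b₀ b₁} →
  (j + + 2) * a₀ * a₀ ≡ j * b₀ + + 2 →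
  (j + + 2) * a₁ * a₁ ≡ j * b₁ + + 2 →
  (j + + 2) * a₀ * a₁ ≡ b₀ + b₁ + j →
  ((j + + 2) * (j * a₁ - a₀) * (j * a₁ - a₀) ≡ j * ((j * j - + 2) * b₁ - b₀) + + 2)
  × ((j + + 2) * a₁ * (j * a₁ - a₀) ≡ b₁ + ((j * j - + 2) * b₁ - b₀) + j)
doubling-step {j} {a₀} {a₁} {b₀} {b₁} sq₀ sq₁ cr₀ = sq₂ , cr₁
  where
  sq₂ : (j + + 2) * (j * a₁ - a₀) * (j * a₁ - a₀) ≡ j * ((j * j - + 2) * b₁ - b₀) + + 2
  sq₂ = begin
    (j + + 2) * (j * a₁ - a₀) * (j * a₁ - a₀)
      ≡⟨ solve (j ∷ a₀ ∷ a₁ ∷ []) ⟩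
    j * j * ((j + + 2) * a₁ * a₁) - + 2 * j * ((j + + 2) * a₀ * a₁) + (j + + 2) * a₀ * a₀
      ≡⟨ cong₂ (λ x y → j * j * x - + 2 * j * y + (j + + 2) * a₀ * a₀) sq₁ cr₀ ⟩
    j * j * (j * b₁ + + 2) - + 2 * j * (b₀ + b₁ + j) + (j + + 2) * a₀ * a₀
      ≡⟨ cong (λ x → j * j * (j * b₁ + + 2) - + 2 * j * (b₀ + b₁ + j) + x) sq₀ ⟩
    j * j * (j * b₁ + + 2) - + 2 * j * (b₀ + b₁ + j) + (j * b₀ + + 2)
      ≡⟨ solve (j ∷ b₀ ∷ b₁ ∷ []) ⟩
    j * ((j * j - + 2) * b₁ - b₀) + + 2 ∎

  cr₁ : (j + + 2) * a₁ * (j * a₁ - a₀) ≡ b₁ + ((j * j - + 2) * b₁ - b₀) + j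
  cr₁ = begin
    (j + + 2) * a₁ * (j * a₁ - a₀)                   ≡⟨ solve (j ∷ a₀ ∷ a₁ ∷ []) ⟩
    j * ((j + + 2) * a₁ * a₁) - (j + + 2) * a₀ * a₁  ≡⟨ cong₂ (λ x y → j * x - y) sq₁ cr₀ ⟩
    j * (j * b₁ + + 2) - (b₀ + b₁ + j)               ≡⟨ solve (j ∷ b₀ ∷ b₁ ∷ []) ⟩
    b₁ + ((j * j - + 2) * b₁ - b₀) + j               ∎

module _ (j : ℤ) where
  private
    a b : ℕ → ℤ
    a = rFwd j
    b = rFwd (j * j - + 2)

    Square Cross : ℕ → Set
    Square t = (j + + 2) * a t * a t ≡ j * b t + + 2
    Cross t = (j + + 2) * a t * a (suc t) ≡ b t + b (suc t) + j

    square-cross : ∀ t → Square t × Square (suc t) × Cross t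
    square-cross zero = sq₀ , sq₁ , cr₀
      where
      sq₀ : (j + + 2) * + 1 * + 1 ≡ j * + 1 + + 2
      sq₀ = solve (j ∷ [])
      sq₁ : (j + + 2) * (j - + 1) * (j - + 1) ≡ j * ((j * j - + 2) - + 1) + + 2
      sq₁ = solve (j ∷ [])
      cr₀ : (j + + 2) * + 1 * (j - + 1) ≡ + 1 + ((j * j - + 2) - + 1) + j
      cr₀ = solve (j ∷ [])
    square-cross (suc t) with square-cross t
    ... | sq₀ , sq₁ , cr₀ = sq₁ , doubling-step {j} sq₀ sq₁ cr₀

  r-doubling : ∀ t → (j + + 2) * rFwd j t * rFwd j t ≡ j * rFwd (j * j - + 2) t + + 2
  r-doubling t = proj₁ (square-cross t)

-- For k ≥ 0 the paper's f⁺_k(j) and f⁻_k(j) are factor j c k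
-- with c = 2ℓ(ℓ − 1) and c = 2ℓ(ℓ + 1) respectively.
factor : ℤ → ℤ → ℕ → ℤ
factor j c zero = + 1
factor j c (suc zero) = c - + 1
factor j c (suc (suc t)) = c * rFwd j (suc t) - factor j c t

factor-spec : ∀ j ℓ ε c → (ℓ + ε) * c ≡ ℓ * j → ∀ t →
              (ℓ + ε) * factor j c t ≡ ℓ * rFwd j t + ε * δ (+ t)
factor-spec j ℓ ε c ℓ+ε∣ℓj = spec
  where
  step : ∀ a₀ a₁ f₀ d₀ → (ℓ + ε) * f₀ ≡ ℓ * a₀ + ε * d₀ →
         (ℓ + ε) * (c * a₁ - f₀) ≡ ℓ * (j * a₁ - a₀) + ε * - d₀
  step a₀ a₁ f₀ d₀ spec₀ = begin
    (ℓ + ε) * (c * a₁ - f₀)            ≡⟨ solve (ℓ ∷ ε ∷ c ∷ a₁ ∷ f₀ ∷ []) ⟩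
    (ℓ + ε) * c * a₁ - (ℓ + ε) * f₀    ≡⟨ cong₂ (λ x y → x * a₁ - y) ℓ+ε∣ℓj spec₀ ⟩
    ℓ * j * a₁ - (ℓ * a₀ + ε * d₀)     ≡⟨ solve (j ∷ ℓ ∷ ε ∷ a₀ ∷ a₁ ∷ d₀ ∷ []) ⟩
    ℓ * (j * a₁ - a₀) + ε * - d₀       ∎

  spec : ∀ t → (ℓ + ε) * factor j c t ≡ ℓ * rFwd j t + ε * δ (+ t)
  spec zero = solve (j ∷ ℓ ∷ ε ∷ [])
  spec (suc zero) = begin
    (ℓ + ε) * (c - + 1)       ≡⟨ solve (ℓ ∷ ε ∷ c ∷ []) ⟩
    (ℓ + ε) * c - (ℓ + ε)     ≡⟨ cong (_- (ℓ + ε)) ℓ+ε∣ℓj ⟩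
    ℓ * j - (ℓ + ε)           ≡⟨ solve (j ∷ ℓ ∷ ε ∷ []) ⟩
    ℓ * (j - + 1) + ε * - + 1 ∎
  spec (suc (suc t)) = begin
    (ℓ + ε) * (c * rFwd j (suc t) - factor j c t)
      ≡⟨ step (rFwd j t) (rFwd j (suc t)) (factor j c t) (δ (+ t)) (spec t) ⟩
    ℓ * (j * rFwd j (suc t) - rFwd j t) + ε * - δ (+ t)
      ≡⟨ cong (λ d → ℓ * (j * rFwd j (suc t) - rFwd j t) + ε * d) (δ-suc-suc t) ⟨
    ℓ * (j * rFwd j (suc t) - rFwd j t) + ε * δ (+ suc (suc t)) ∎

Factorisation : (ℓ rʲ rⁿ d : ℤ) → Set
Factorisation ℓ rʲ rⁿ d = Σ ℤ λ fp → Σ ℤ λ fm →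
  ((ℓ + + 1) * fp ≡ ℓ * rʲ + d) × ((ℓ - + 1) * fm ≡ ℓ * rʲ - d) × (rⁿ ≡ fp * fm)

Factorisation-cong : ∀ {ℓ rʲ rʲ′ rⁿ rⁿ′ d d′} → rʲ ≡ rʲ′ → rⁿ ≡ rⁿ′ → d ≡ d′ →
                     Factorisation ℓ rʲ rⁿ d → Factorisation ℓ rʲ′ rⁿ′ d′
Factorisation-cong refl refl refl f = f

2≤ℓ⇒2[ℓ²-1]≢0 : ∀ {ℓ} → + 2 ≤ ℓ → NonZero (+ 2 * (ℓ * ℓ - + 1))
2≤ℓ⇒2[ℓ²-1]≢0 (+≤+ (s≤s (s≤s _))) = _

factors-product : ∀ ℓ a b d p m →
  (ℓ + + 1) * p ≡ ℓ * a + d → (ℓ - + 1) * m ≡ ℓ * a - d → d * d ≡ + 1 →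
  (+ 2 * (ℓ * ℓ - + 1) + + 2) * a * a ≡ + 2 * (ℓ * ℓ - + 1) * b + + 2 →
  + 2 * (ℓ * ℓ - + 1) * (p * m) ≡ + 2 * (ℓ * ℓ - + 1) * b
factors-product ℓ a b d p m p-spec m-spec d²≡1 doubling = begin
  + 2 * (ℓ * ℓ - + 1) * (p * m)               ≡⟨ solve (ℓ ∷ p ∷ m ∷ []) ⟩
  + 2 * (((ℓ + + 1) * p) * ((ℓ - + 1) * m))   ≡⟨ cong₂ (λ x y → + 2 * (x * y)) p-spec m-spec ⟩
  + 2 * ((ℓ * a + d) * (ℓ * a - d))           ≡⟨ solve (ℓ ∷ a ∷ d ∷ []) ⟩
  (+ 2 * (ℓ * ℓ - + 1) + + 2) * a * a - + 2 * (d * d)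
    ≡⟨ cong₂ (λ x y → x - + 2 * y) doubling d²≡1 ⟩
  + 2 * (ℓ * ℓ - + 1) * b + + 2 - + 2 * + 1   ≡⟨ solve (ℓ ∷ b ∷ []) ⟩
  + 2 * (ℓ * ℓ - + 1) * b                     ∎

module _ (ℓ : ℤ) where
  private
    j : ℤ
    j = + 2 * (ℓ * ℓ - + 1)

    f⁺ f⁻ : ℕ → ℤ
    f⁺ = factor j (+ 2 * ℓ * (ℓ - + 1))
    f⁻ = factor j (+ 2 * ℓ * (ℓ + + 1))

    ℓ+1∣ℓj : (ℓ + + 1) * (+ 2 * ℓ * (ℓ - + 1)) ≡ ℓ * (+ 2 * (ℓ * ℓ - + 1))
    ℓ+1∣ℓj = solve (ℓ ∷ [])

    ℓ-1∣ℓj : (ℓ - + 1) * (+ 2 * ℓ * (ℓ + + 1)) ≡ ℓ * (+ 2 * (ℓ * ℓ - + 1))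
    ℓ-1∣ℓj = solve (ℓ ∷ [])

    f⁺-spec : ∀ t → (ℓ + + 1) * f⁺ t ≡ ℓ * rFwd j t + δ (+ t)
    f⁺-spec t = trans (factor-spec j ℓ (+ 1) _ ℓ+1∣ℓj t)
                      (cong (λ x → ℓ * rFwd j t + x) (*-identityˡ (δ (+ t))))

    f⁻-spec : ∀ t → (ℓ - + 1) * f⁻ t ≡ ℓ * rFwd j t - δ (+ t)
    f⁻-spec t = trans (factor-spec j ℓ (- + 1) _ ℓ-1∣ℓj t)
                      (cong (λ x → ℓ * rFwd j t + x) (-1*i≡-i (δ (+ t))))

  factorisation : + 2 ≤ ℓ → ∀ t → Factorisation ℓ (rFwd j t) (rFwd (j * j - + 2) t) (δ (+ t))
  factorisation 2≤ℓ t = f⁺ t , f⁻ t , f⁺-spec t , f⁻-spec t ,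
    sym (*-cancelˡ-≡ j (f⁺ t * f⁻ t) (rFwd (j * j - + 2) t) ⦃ 2≤ℓ⇒2[ℓ²-1]≢0 2≤ℓ ⦄
      (factors-product ℓ (rFwd j t) (rFwd (j * j - + 2) t) (δ (+ t)) (f⁺ t) (f⁻ t)
        (f⁺-spec t) (f⁻-spec t) (δ*δ≡1 (+ t)) (r-doubling j t)))

theorem43 : (ℓ : ℤ) → + 2 ≤ ℓ → (k : ℤ) →
    Σ ℤ (λ fp → Σ ℤ (λ fm →
      ((ℓ + + 1) * fp ≡ ℓ * r k (+ 2 * (ℓ * ℓ - + 1)) + δ k)
      × ((ℓ - + 1) * fm ≡ ℓ * r k (+ 2 * (ℓ * ℓ - + 1)) - δ k)
      × (r k ((+ 2 * (ℓ * ℓ - + 1)) * (+ 2 * (ℓ * ℓ - + 1)) - + 2) ≡ fp * fm)))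
theorem43 ℓ 2≤ℓ (+ t) = factorisation ℓ 2≤ℓ t
theorem43 ℓ 2≤ℓ -[1+ t ] =
  Factorisation-cong {ℓ} (sym (r-neg t)) (sym (r-neg t)) (sym (δ-neg t)) (factorisation ℓ 2≤ℓ t)
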